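{- Let $n\ge 1$. Let $A_n$ be the set of binary plane trees on $n$ vertices in which three vertices, whose associated entries form a copy of the pattern $213$, are colored black, and let $B_n$ be the set of binary plane trees on $n$ vertices in which three vertices, whose associated entries form a copy of the pattern $231$, are colored black. Define $f$ on $A_n$ as follows. For $T\in A_n$, let $Q_2,Q_1,Q_3$ be the three black vertices listed in in-order (so their associated entries play the roles of $2,1,3$ respectively). (Case 1) If $Q_1$ is a right descendant of $Q_2$ and $Q_2$ is a left descendant of $Q_3$, then $f(T)$ is obtained from $T$ by interchanging the right subtree of $Q_2$ with the right subtree of $Q_3$, keeping the vertices $Q_1,Q_2,Q_3$ black (with $Q_1$ moving along with its subtree). (Case 2) Otherwise, there is a lowest left descendant $Q_x$ of $Q_3$ such that $Q_2$ is a left descendant of $Q_x$ and $Q_1$ is a right descendant of $Q_x$; then $f(T)$ is obtained from $T$ by interchanging the right subtree of $Q_x$ with the right subtree of $Q_3$, and coloring $Q_2,Q_x,Q_1$ black (and $Q_3$ no longer black). Then $f$ is a bijection from $A_n$ to $B_n$.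
   Context: A binary plane tree is a rooted unlabeled tree in which each vertex has at most two children, each child being designated a left child or a right child of its parent (even if it is the only child). A left (resp. right) descendant of a vertex $x$ is a vertex of the left (resp. right) subtree of $x$ (not including $x$ itself). The in-order reading of a binary plane tree reads the left subtree of the root (recursively), then the root, then the right subtree of the root (recursively). There is a standard bijection between $132$-avoiding permutations of length $n$ and binary plane trees on $n$ vertices: for a $132$-avoiding $p$, the root of $T(p)$ corresponds to the entry $n$, the left subtree is recursively built from the entries to the left of $n$, and the right subtree from the entries to the right of $n$; each vertex is thereby associated to an entry of $p$ (the largest entry of the subtree it roots), and reading the vertices in in-order recovers $p$. Entries associated to vertices form a copy of a pattern $q$ if they do so in $p$ (a copy of $q=q_1\cdots q_k$ in $p$ is a subsequence $p_{i_1}\cdots p_{i_k}$, $i_1<\cdots<i_k$, with $p_{i_t}<p_{i_u}$ iff $q_t<q_u$). -}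

module Defs where

open import Data.Nat using (ℕ; zero; suc; _+_; _<_)
open import Data.Bool using (Bool; true; false; _∧_; if_then_else_)
open import Data.List using (List; []; _∷_; _++_; map; length; drop; inits; last; filterᵇ)
open import Data.Maybe using (Maybe; just; nothing)
open import Data.Product using (_×_; _,_; Σ)
open import Data.Unit using (⊤)
open import Data.Empty using (⊥)
open import Relation.Binary.PropositionalEquality using (_≡_)

-- Binary plane trees: lf is the empty tree, nd l r a vertex with
-- left subtree l and right subtree r (an empty subtree = no child).
data Tree : Set where
  lf : Tree
  nd : Tree → Tree → Tree

size : Tree → ℕ
size lf = 0
size (nd l r) = size l + 1 + size r

-- Vertices are addressed by their path from the root.
data Dir : Set where
  L R : Dir

Path : Set
Path = List Dir

Vertex : Tree → Path → Set
Vertex lf _ = ⊥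
Vertex (nd l r) [] = ⊤
Vertex (nd l r) (L ∷ p) = Vertex l p
Vertex (nd l r) (R ∷ p) = Vertex r p

-- position (0-based) of a vertex in the in-order reading
inIdx : Tree → Path → ℕ
inIdx lf _ = 0
inIdx (nd l r) [] = size l
inIdx (nd l r) (L ∷ p) = inIdx l p
inIdx (nd l r) (R ∷ p) = size l + 1 + inIdx r p

-- The 132-avoiding permutation p with T(p) = T (inverse of the standard
-- bijection): the root is the maximal entry, the entries left of it
-- (left subtree) are all larger than those right of it (right subtree).
perm : Tree → List ℕ
perm lf = []
perm (nd l r) = map (λ x → x + size r) (perm l) ++ ((size l + 1 + size r) ∷ perm r)

at : List ℕ → ℕ → ℕ
at [] _ = 0
at (x ∷ xs) zero = x
at (x ∷ xs) (suc k) = at xs k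

entry : Tree → Path → ℕ
entry T q = at (perm T) (inIdx T q)

-- Coloured trees: a tree with three black vertices, listed in in-order.
ColTree : Set
ColTree = Tree × Path × Path × Path

InA : ℕ → ColTree → Set
InA n (T , a , b , c) =
  size T ≡ n × Vertex T a × Vertex T b × Vertex T c ×
  inIdx T a < inIdx T b × inIdx T b < inIdx T c ×
  entry T b < entry T a × entry T a < entry T c

InB : ℕ → ColTree → Set
InB n (T , a , b , c) =
  size T ≡ n × Vertex T a × Vertex T b × Vertex T c ×
  inIdx T a < inIdx T b × inIdx T b < inIdx T c ×
  entry T c < entry T a × entry T a < entry T b

_==d_ : Dir → Dir → Bool
L ==d L = true
R ==d R = true
_ ==d _ = false

isPrefix : Path → Path → Bool
isPrefix [] _ = true
isPrefix (_ ∷ _) [] = false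
isPrefix (d ∷ p) (e ∷ q) = (d ==d e) ∧ isPrefix p q

isLeftDesc : Path → Path → Bool
isLeftDesc q x = isPrefix (x ++ (L ∷ [])) q

isRightDesc : Path → Path → Bool
isRightDesc q x = isPrefix (x ++ (R ∷ [])) q

subtreeAt : Tree → Path → Tree
subtreeAt T [] = T
subtreeAt lf (_ ∷ _) = lf
subtreeAt (nd l r) (L ∷ p) = subtreeAt l p
subtreeAt (nd l r) (R ∷ p) = subtreeAt r p

replaceAt : Tree → Path → Tree → Tree
replaceAt T [] S = S
replaceAt lf (_ ∷ _) S = lf
replaceAt (nd l r) (L ∷ p) S = nd (replaceAt l p S) r
replaceAt (nd l r) (R ∷ p) S = nd l (replaceAt r p S)

swapRight : Tree → Path → Path → Tree
swapRight T x y =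
  replaceAt (replaceAt T (x ++ (R ∷ [])) (subtreeAt T (y ++ (R ∷ []))))
            (y ++ (R ∷ [])) (subtreeAt T (x ++ (R ∷ [])))

-- the lowest left descendant x of q3 with q2 a left descendant of x and
-- q1 a right descendant of x (candidates are ancestors of q2, so prefixes of q2;
-- lowest = longest)
lowestQx : Path → Path → Path → Maybe Path
lowestQx q2 q1 q3 =
  last (filterᵇ (λ x → isLeftDesc x q3 ∧ isLeftDesc q2 x ∧ isRightDesc q1 x) (inits q2))

-- the map f (output black vertices again listed in in-order)

f : ColTree → ColTree
f (T , q2 , q1 , q3) with isRightDesc q1 q2 ∧ isLeftDesc q2 q3
... | true = (swapRight T q2 q3 , q2 , q3 , q3 ++ drop (length q2) q1)
... | false with lowestQx q2 q1 q3
...   | just qx = (swapRight T qx q3 , q2 , qx , q3 ++ drop (length qx) q1)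
...   | nothing = (T , q2 , q1 , q3)

-- If u precedes v in in-order, the entry of u in the 132-avoiding permutation
-- is smaller than that of v exactly when u is a left descendant of v.  Hence
-- vertices a, b, c (in in-order) carry a 213 iff a is a left descendant of c
-- but not of b, and a 231 iff a is a left descendant of b but not of c.
-- Solving these conditions on paths, both kinds of triples are described by
-- the same data: an apex c, a pivot x = c L u, the vertex x R t, and in the
-- second case the vertex x L v.  In these terms f keeps the data and exchanges
-- the right subtrees of x and c, a size-preserving involution that carries the
-- vertices of the 213-triple onto those of the 231-triple and back.
module Submission where

open import Defs
open import Data.Nat using (ℕ; zero; suc; _+_; _≤_; _<_; z≤n; s≤s)
open import Data.Nat.Properties
open import Data.Nat.Tactic.RingSolver using (solve-∀)
open import Data.Bool using (Bool; true; false; _∧_)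
open import Data.Bool.Properties using (∧-zeroʳ)
open import Data.List using (List; []; _∷_; _++_; map; length; drop; inits; last; filterᵇ)
open import Data.List.Properties using (++-assoc; ++-identityʳ; ++-cancelˡ; length-map; length-++; ∷-injectiveˡ; ∷-injectiveʳ; last-map)
import Data.Maybe as Maybe
open import Data.Maybe using (just)
open import Data.Product using (_×_; _,_; Σ; ∃; proj₁; proj₂)
open import Data.Sum using (_⊎_; inj₁; inj₂)
open import Data.Unit using (tt)
open import Data.Empty using (⊥-elim)
open import Function using (_∘_; _⇔_; mk⇔; Equivalence)
open import Relation.Nullary using (¬_)
open import Relation.Binary.PropositionalEquality

private variable
  A : Set
  p q u v : Path
  n : ℕ

-- p ≺ q : p comes before q in the in-order reading.
infix 4 _≺_ _◁_
data _≺_ : Path → Path → Set where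
  L≺L  : p ≺ q → L ∷ p ≺ L ∷ q
  R≺R  : p ≺ q → R ∷ p ≺ R ∷ q
  L≺[] : L ∷ p ≺ []
  L≺R  : L ∷ p ≺ R ∷ q
  []≺R : [] ≺ R ∷ q

≺-trans : ∀ {a b c} → a ≺ b → b ≺ c → a ≺ c
≺-trans (L≺L ab) (L≺L bc) = L≺L (≺-trans ab bc)
≺-trans (L≺L _)  L≺[]     = L≺[]
≺-trans (L≺L _)  L≺R      = L≺R
≺-trans (R≺R ab) (R≺R bc) = R≺R (≺-trans ab bc)
≺-trans L≺[]     []≺R     = L≺R
≺-trans L≺R      (R≺R _)  = L≺R
≺-trans []≺R     (R≺R _)  = []≺R

≡⊎≺⊎≻ : ∀ p q → p ≡ q ⊎ p ≺ q ⊎ q ≺ p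
≡⊎≺⊎≻ []      []      = inj₁ refl
≡⊎≺⊎≻ []      (L ∷ q) = inj₂ (inj₂ L≺[])
≡⊎≺⊎≻ []      (R ∷ q) = inj₂ (inj₁ []≺R)
≡⊎≺⊎≻ (L ∷ p) []      = inj₂ (inj₁ L≺[])
≡⊎≺⊎≻ (R ∷ p) []      = inj₂ (inj₂ []≺R)
≡⊎≺⊎≻ (L ∷ p) (R ∷ q) = inj₂ (inj₁ L≺R)
≡⊎≺⊎≻ (R ∷ p) (L ∷ q) = inj₂ (inj₂ L≺R)
≡⊎≺⊎≻ (L ∷ p) (L ∷ q) with ≡⊎≺⊎≻ p q
... | inj₁ refl       = inj₁ refl
... | inj₂ (inj₁ p≺q) = inj₂ (inj₁ (L≺L p≺q))
... | inj₂ (inj₂ q≺p) = inj₂ (inj₂ (L≺L q≺p))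
≡⊎≺⊎≻ (R ∷ p) (R ∷ q) with ≡⊎≺⊎≻ p q
... | inj₁ refl       = inj₁ refl
... | inj₂ (inj₁ p≺q) = inj₂ (inj₁ (R≺R p≺q))
... | inj₂ (inj₂ q≺p) = inj₂ (inj₂ (R≺R q≺p))

≺-++ˡ : ∀ c → p ≺ q → c ++ p ≺ c ++ q
≺-++ˡ []      p≺q = p≺q
≺-++ˡ (L ∷ c) p≺q = L≺L (≺-++ˡ c p≺q)
≺-++ˡ (R ∷ c) p≺q = R≺R (≺-++ˡ c p≺q)

p++L∷s≺p : ∀ p s → p ++ L ∷ s ≺ p
p++L∷s≺p []      s = L≺[]
p++L∷s≺p (L ∷ p) s = L≺L (p++L∷s≺p p s)
p++L∷s≺p (R ∷ p) s = R≺R (p++L∷s≺p p s)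

p≺p++R∷t : ∀ p t → p ≺ p ++ R ∷ t
p≺p++R∷t []      t = []≺R
p≺p++R∷t (L ∷ p) t = L≺L (p≺p++R∷t p t)
p≺p++R∷t (R ∷ p) t = R≺R (p≺p++R∷t p t)

data _◁_ : Path → Path → Set where
  ◁-here  : ∀ {s} → L ∷ s ◁ []
  ◁-there : ∀ {d} → u ◁ v → d ∷ u ◁ d ∷ v

◁⇒≡++L∷ : u ◁ v → ∃ λ s → u ≡ v ++ L ∷ s
◁⇒≡++L∷ (◁-here {s}) = s , refl
◁⇒≡++L∷ (◁-there u◁v) with s , refl ← ◁⇒≡++L∷ u◁v = s , refl

◁-++ˡ : ∀ c → u ◁ v → c ++ u ◁ c ++ v
◁-++ˡ []      u◁v = u◁v
◁-++ˡ (d ∷ c) u◁v = ◁-there (◁-++ˡ c u◁v)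

⋪-++ˡ : ∀ c → ¬ u ◁ v → ¬ c ++ u ◁ c ++ v
⋪-++ˡ []      u⋪v = u⋪v
⋪-++ˡ (d ∷ c) u⋪v (◁-there h) = ⋪-++ˡ c u⋪v h

p++L∷s◁p : ∀ p s → p ++ L ∷ s ◁ p
p++L∷s◁p p s = subst (p ++ L ∷ s ◁_) (++-identityʳ p) (◁-++ˡ p ◁-here)

p⋪p++R∷t : ∀ p t → ¬ p ◁ p ++ R ∷ t
p⋪p++R∷t (d ∷ p) t (◁-there h) = p⋪p++R∷t p t h

data ≺-View : Path → Path → Set where
  left-desc  : ∀ q s → ≺-View (q ++ L ∷ s) q
  right-desc : ∀ p t → ≺-View p (p ++ R ∷ t)
  fork       : ∀ u v t → ≺-View (u ++ L ∷ v) (u ++ R ∷ t)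

∷-≺-View : ∀ d → ≺-View p q → ≺-View (d ∷ p) (d ∷ q)
∷-≺-View d (left-desc q s)  = left-desc (d ∷ q) s
∷-≺-View d (right-desc p t) = right-desc (d ∷ p) t
∷-≺-View d (fork u v t)     = fork (d ∷ u) v t

≺-view : p ≺ q → ≺-View p q
≺-view (L≺L p≺q)     = ∷-≺-View L (≺-view p≺q)
≺-view (R≺R p≺q)     = ∷-≺-View R (≺-view p≺q)
≺-view (L≺[] {p})    = left-desc [] p
≺-view (L≺R {p} {q}) = fork [] p q
≺-view ([]≺R {q})    = right-desc [] q

m<m+1+n : ∀ m n → m < m + 1 + n
m<m+1+n m n = ≤-trans (≤-reflexive (sym (+-comm m 1))) (m≤m+n (m + 1) n)

inIdx<size : ∀ T p → Vertex T p → inIdx T p < size T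
inIdx<size (nd l r) []      _ = m<m+1+n (size l) (size r)
inIdx<size (nd l r) (L ∷ p) v = <-≤-trans (inIdx<size l p v) (<⇒≤ (m<m+1+n (size l) (size r)))
inIdx<size (nd l r) (R ∷ p) v = +-monoʳ-< (size l + 1) (inIdx<size r p v)

≺⇒inIdx< : ∀ T {p q} → Vertex T p → Vertex T q → p ≺ q → inIdx T p < inIdx T q
≺⇒inIdx< (nd l r) vp vq (L≺L p≺q) = ≺⇒inIdx< l vp vq p≺q
≺⇒inIdx< (nd l r) vp vq (R≺R p≺q) = +-monoʳ-< (size l + 1) (≺⇒inIdx< r vp vq p≺q)
≺⇒inIdx< (nd l r) {L ∷ p} vp vq L≺[] = inIdx<size l p vp
≺⇒inIdx< (nd l r) {L ∷ p} {R ∷ q} vp vq L≺R =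
  <-≤-trans (inIdx<size l p vp) (<⇒≤ (m<m+1+n (size l) (inIdx r q)))
≺⇒inIdx< (nd l r) {q = R ∷ q} vp vq []≺R = m<m+1+n (size l) (inIdx r q)

inIdx<⇒≺ : ∀ T {p q} → Vertex T p → Vertex T q → inIdx T p < inIdx T q → p ≺ q
inIdx<⇒≺ T {p} {q} vp vq i<j with ≡⊎≺⊎≻ p q
... | inj₁ refl       = ⊥-elim (<-irrefl refl i<j)
... | inj₂ (inj₁ p≺q) = p≺q
... | inj₂ (inj₂ q≺p) = ⊥-elim (<-asym i<j (≺⇒inIdx< T vq vp q≺p))

-- Entries of the 132-avoiding permutation

length-perm : ∀ T → length (perm T) ≡ size T
length-perm lf = refl
length-perm (nd l r) = begin
  length (map (_+ size r) (perm l) ++ (size l + 1 + size r) ∷ perm r)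
    ≡⟨ length-++ (map (_+ size r) (perm l)) ⟩
  length (map (_+ size r) (perm l)) + suc (length (perm r))
    ≡⟨ cong₂ (λ a b → a + suc b) (trans (length-map _ (perm l)) (length-perm l)) (length-perm r) ⟩
  size l + suc (size r)
    ≡⟨ sym (+-assoc (size l) 1 (size r)) ⟩
  size l + 1 + size r ∎
  where open ≡-Reasoning

at-++ˡ : ∀ xs ys i → i < length xs → at (xs ++ ys) i ≡ at xs i
at-++ˡ (x ∷ xs) ys zero    _         = refl
at-++ˡ (x ∷ xs) ys (suc i) (s≤s i<n) = at-++ˡ xs ys i i<n

at-map : ∀ (g : ℕ → ℕ) xs i → i < length xs → at (map g xs) i ≡ g (at xs i)
at-map g (x ∷ xs) zero    _         = refl
at-map g (x ∷ xs) (suc i) (s≤s i<n) = at-map g xs i i<n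

at-++-∷ : ∀ xs y ys → at (xs ++ y ∷ ys) (length xs) ≡ y
at-++-∷ []       y ys = refl
at-++-∷ (x ∷ xs) y ys = at-++-∷ xs y ys

at-++-∷ʳ : ∀ xs y ys k → at (xs ++ y ∷ ys) (length xs + 1 + k) ≡ at ys k
at-++-∷ʳ []       y ys k = refl
at-++-∷ʳ (x ∷ xs) y ys k = at-++-∷ʳ xs y ys k

module _ (l r : Tree) where
  private
    shifted = map (_+ size r) (perm l)

    length-shifted : length shifted ≡ size l
    length-shifted = trans (length-map _ (perm l)) (length-perm l)

  entry-L∷ : ∀ p → Vertex l p → entry (nd l r) (L ∷ p) ≡ entry l p + size r
  entry-L∷ p v = trans (at-++ˡ shifted _ i (subst (i <_) (sym length-shifted) i<size))
                       (at-map (_+ size r) (perm l) i (subst (i <_) (sym (length-perm l)) i<size))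
    where
    i = inIdx l p
    i<size = inIdx<size l p v

  entry-R∷ : ∀ p → entry (nd l r) (R ∷ p) ≡ entry r p
  entry-R∷ p = subst (λ m → at (shifted ++ size (nd l r) ∷ perm r) (m + 1 + inIdx r p) ≡ entry r p)
                     length-shifted (at-++-∷ʳ shifted (size (nd l r)) (perm r) (inIdx r p))

  entry-root : entry (nd l r) [] ≡ size l + 1 + size r
  entry-root = subst (λ m → at (shifted ++ size (nd l r) ∷ perm r) m ≡ size l + 1 + size r)
                     length-shifted (at-++-∷ shifted (size (nd l r)) (perm r))

0<entry : ∀ T p → Vertex T p → 0 < entry T p
0<entry (nd l r) [] _ rewrite entry-root l r = ≤-<-trans z≤n (m<m+1+n (size l) (size r))
0<entry (nd l r) (L ∷ p) v rewrite entry-L∷ l r p v = <-≤-trans (0<entry l p v) (m≤m+n _ (size r))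
0<entry (nd l r) (R ∷ p) v rewrite entry-R∷ l r p = 0<entry r p v

entry≤size : ∀ T p → Vertex T p → entry T p ≤ size T
entry≤size (nd l r) [] _ rewrite entry-root l r = ≤-refl
entry≤size (nd l r) (L ∷ p) v rewrite entry-L∷ l r p v =
  +-monoˡ-≤ (size r) (≤-trans (entry≤size l p v) (m≤m+n (size l) 1))
entry≤size (nd l r) (R ∷ p) v rewrite entry-R∷ l r p = ≤-trans (entry≤size r p v) (m≤n+m (size r) (size l + 1))

entry-dichotomy : ∀ T {u v} → Vertex T u → Vertex T v → u ≺ v →
  (u ◁ v × entry T u < entry T v) ⊎ (¬ u ◁ v × entry T v < entry T u)
entry-dichotomy (nd l r) {L ∷ p} {L ∷ q} vu vv (L≺L p≺q)
  rewrite entry-L∷ l r p vu | entry-L∷ l r q vv with entry-dichotomy l vu vv p≺q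
... | inj₁ (p◁q , lt) = inj₁ (◁-there p◁q , +-monoˡ-< (size r) lt)
... | inj₂ (p⋪q , lt) = inj₂ ((λ { (◁-there p◁q) → p⋪q p◁q }) , +-monoˡ-< (size r) lt)
entry-dichotomy (nd l r) {R ∷ p} {R ∷ q} vu vv (R≺R p≺q)
  rewrite entry-R∷ l r p | entry-R∷ l r q with entry-dichotomy r vu vv p≺q
... | inj₁ (p◁q , lt) = inj₁ (◁-there p◁q , lt)
... | inj₂ (p⋪q , lt) = inj₂ ((λ { (◁-there p◁q) → p⋪q p◁q }) , lt)
entry-dichotomy (nd l r) {L ∷ p} vu vv L≺[] rewrite entry-L∷ l r p vu | entry-root l r =
  inj₁ (◁-here , +-monoˡ-< (size r) (≤-<-trans (entry≤size l p vu) (m<m+n (size l) (s≤s z≤n))))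
entry-dichotomy (nd l r) {L ∷ p} {R ∷ q} vu vv L≺R rewrite entry-L∷ l r p vu | entry-R∷ l r q =
  inj₂ ((λ ()) , ≤-<-trans (entry≤size r q vv) (+-monoˡ-< (size r) (0<entry l p vu)))
entry-dichotomy (nd l r) {v = R ∷ q} vu vv []≺R rewrite entry-R∷ l r q | entry-root l r =
  inj₂ ((λ ()) , ≤-<-trans (entry≤size r q vv) (+-monoˡ-< (size r) (m≤n+m 1 (size l))))

entry<⇔◁ : ∀ T {u v} → Vertex T u → Vertex T v → u ≺ v → (entry T u < entry T v ⇔ u ◁ v)
entry<⇔◁ T vu vv u≺v with entry-dichotomy T vu vv u≺v
... | inj₁ (u◁v , lt) = mk⇔ (λ _ → u◁v) (λ _ → lt)
... | inj₂ (u⋪v , gt) = mk⇔ (λ lt → ⊥-elim (<-asym lt gt)) (λ u◁v → ⊥-elim (u⋪v u◁v))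

entry>⇔⋪ : ∀ T {u v} → Vertex T u → Vertex T v → u ≺ v → (entry T v < entry T u ⇔ (¬ u ◁ v))
entry>⇔⋪ T vu vv u≺v with entry-dichotomy T vu vv u≺v
... | inj₁ (u◁v , lt) = mk⇔ (λ gt → ⊥-elim (<-asym lt gt)) (λ u⋪v → ⊥-elim (u⋪v u◁v))
... | inj₂ (u⋪v , gt) = mk⇔ (λ _ → u⋪v) (λ _ → gt)

Triple : Set
Triple = Path × Path × Path

Vertices : Tree → Triple → Set
Vertices T (a , b , c) = Vertex T a × Vertex T b × Vertex T c

Order213 Order231 : Triple → Set
Order213 (a , b , c) = a ≺ b × b ≺ c × ¬ a ◁ b × a ◁ c
Order231 (a , b , c) = a ≺ b × b ≺ c × a ◁ b × ¬ a ◁ c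

InA⇔ : ∀ T abc → InA n (T , abc) ⇔ (size T ≡ n × Vertices T abc × Order213 abc)
InA⇔ T (a , b , c) = mk⇔
  (λ (sz , va , vb , vc , iab , ibc , eba , eac) →
    let a≺b = inIdx<⇒≺ T va vb iab
        b≺c = inIdx<⇒≺ T vb vc ibc
    in sz , (va , vb , vc) , a≺b , b≺c ,
       Equivalence.to (entry>⇔⋪ T va vb a≺b) eba ,
       Equivalence.to (entry<⇔◁ T va vc (≺-trans a≺b b≺c)) eac)
  (λ (sz , (va , vb , vc) , a≺b , b≺c , a⋪b , a◁c) →
    sz , va , vb , vc , ≺⇒inIdx< T va vb a≺b , ≺⇒inIdx< T vb vc b≺c ,
    Equivalence.from (entry>⇔⋪ T va vb a≺b) a⋪b ,
    Equivalence.from (entry<⇔◁ T va vc (≺-trans a≺b b≺c)) a◁c)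

InB⇔ : ∀ T abc → InB n (T , abc) ⇔ (size T ≡ n × Vertices T abc × Order231 abc)
InB⇔ T (a , b , c) = mk⇔
  (λ (sz , va , vb , vc , iab , ibc , eca , eab) →
    let a≺b = inIdx<⇒≺ T va vb iab
        b≺c = inIdx<⇒≺ T vb vc ibc
    in sz , (va , vb , vc) , a≺b , b≺c ,
       Equivalence.to (entry<⇔◁ T va vb a≺b) eab ,
       Equivalence.to (entry>⇔⋪ T va vc (≺-trans a≺b b≺c)) eca)
  (λ (sz , (va , vb , vc) , a≺b , b≺c , a◁b , a⋪c) →
    sz , va , vb , vc , ≺⇒inIdx< T va vb a≺b , ≺⇒inIdx< T vb vc b≺c ,
    Equivalence.from (entry>⇔⋪ T va vc (≺-trans a≺b b≺c)) a⋪c ,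
    Equivalence.from (entry<⇔◁ T va vb a≺b) a◁b)

-- The two cases of f by the paths of the black vertices: Q₃ = c is the apex,
-- whose right subtree is exchanged with that of the pivot c ++ L ∷ u (Q₂ in
-- case 1, Qₓ in case 2); Q₁ = pivot ++ R ∷ t, and in case 2 Q₂ = pivot ++ L ∷ v.
data Config : Set where
  adjacent  : (c u t : Path) → Config
  separated : (c u v t : Path) → Config

apex pivot : Config → Path
apex (adjacent c _ _)    = c
apex (separated c _ _ _) = c
pivot (adjacent c u _)    = c ++ L ∷ u
pivot (separated c u _ _) = c ++ L ∷ u

blacks213 blacks231 : Config → Triple
blacks213 (adjacent c u t)    = c ++ L ∷ u , c ++ L ∷ (u ++ R ∷ t) , c
blacks213 (separated c u v t) = c ++ L ∷ (u ++ L ∷ v) , c ++ L ∷ (u ++ R ∷ t) , c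
blacks231 (adjacent c u t)    = c ++ L ∷ u , c , c ++ R ∷ t
blacks231 (separated c u v t) = c ++ L ∷ (u ++ L ∷ v) , c ++ L ∷ u , c ++ R ∷ t

blacks213-order : ∀ k → Order213 (blacks213 k)
blacks213-order (adjacent c u t) =
  ≺-++ˡ c (L≺L (p≺p++R∷t u t)) , p++L∷s≺p c (u ++ R ∷ t) ,
  ⋪-++ˡ c (λ { (◁-there h) → p⋪p++R∷t u t h }) , p++L∷s◁p c u
blacks213-order (separated c u v t) =
  ≺-++ˡ c (L≺L (≺-++ˡ u L≺R)) , p++L∷s≺p c (u ++ R ∷ t) ,
  ⋪-++ˡ c (λ { (◁-there h) → ⋪-++ˡ u (λ ()) h }) , p++L∷s◁p c (u ++ L ∷ v)

blacks231-order : ∀ k → Order231 (blacks231 k)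
blacks231-order (adjacent c u t) =
  p++L∷s≺p c u , p≺p++R∷t c t , p++L∷s◁p c u , ⋪-++ˡ c (λ ())
blacks231-order (separated c u v t) =
  ≺-++ˡ c (L≺L (p++L∷s≺p u v)) , ≺-++ˡ c L≺R ,
  ◁-++ˡ c (◁-there (p++L∷s◁p u v)) , ⋪-++ˡ c (λ ())

∷-blacks213 : ∀ d {a b c} → (∃ λ k → (a , b , c) ≡ blacks213 k) →
  ∃ λ k → (d ∷ a , d ∷ b , d ∷ c) ≡ blacks213 k
∷-blacks213 d (adjacent c u t , refl)    = adjacent (d ∷ c) u t , refl
∷-blacks213 d (separated c u v t , refl) = separated (d ∷ c) u v t , refl

∷-blacks231 : ∀ d {a b c} → (∃ λ k → (a , b , c) ≡ blacks231 k) →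
  ∃ λ k → (d ∷ a , d ∷ b , d ∷ c) ≡ blacks231 k
∷-blacks231 d (adjacent c u t , refl)    = adjacent (d ∷ c) u t , refl
∷-blacks231 d (separated c u v t , refl) = separated (d ∷ c) u v t , refl

order213⇒blacks213 : ∀ {a b c} → Order213 (a , b , c) → ∃ λ k → (a , b , c) ≡ blacks213 k
order213⇒blacks213 (L≺L a≺b , L≺[] , a⋪b , ◁-here) with ≺-view a≺b
... | left-desc q s  = ⊥-elim (a⋪b (◁-there (p++L∷s◁p q s)))
... | right-desc p t = adjacent [] p t , refl
... | fork u v t     = separated [] u v t , refl
order213⇒blacks213 (L≺L a≺b , L≺L b≺c , a⋪b , ◁-there a◁c) =
  ∷-blacks213 L (order213⇒blacks213 (a≺b , b≺c , a⋪b ∘ ◁-there , a◁c))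
order213⇒blacks213 (R≺R a≺b , R≺R b≺c , a⋪b , ◁-there a◁c) =
  ∷-blacks213 R (order213⇒blacks213 (a≺b , b≺c , a⋪b ∘ ◁-there , a◁c))

order231⇒blacks231 : ∀ {a b c} → Order231 (a , b , c) → ∃ λ k → (a , b , c) ≡ blacks231 k
order231⇒blacks231 (a≺b , []≺R {t} , ◁-here {s} , _) = adjacent [] s t , refl
order231⇒blacks231 (_ , L≺[] , ◁-there _ , a⋪c) = ⊥-elim (a⋪c ◁-here)
order231⇒blacks231 (_ , L≺R {b} {t} , ◁-there a◁b , _) with v , refl ← ◁⇒≡++L∷ a◁b =
  separated [] b v t , refl
order231⇒blacks231 (L≺L a≺b , L≺L b≺c , ◁-there a◁b , a⋪c) =
  ∷-blacks231 L (order231⇒blacks231 (a≺b , b≺c , a◁b , a⋪c ∘ ◁-there))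
order231⇒blacks231 (R≺R a≺b , R≺R b≺c , ◁-there a◁b , a⋪c) =
  ∷-blacks231 R (order231⇒blacks231 (a≺b , b≺c , a◁b , a⋪c ∘ ◁-there))

++-∷-cancelˡ : ∀ c {d d′ : Dir} {u u′} → c ++ d ∷ u ≡ c ++ d′ ∷ u′ → u ≡ u′
++-∷-cancelˡ c eq = ∷-injectiveʳ (++-cancelˡ c _ _ eq)

L-branch≢R-branch : ∀ c {u s t} → (c ++ L ∷ u) ++ s ≢ c ++ R ∷ t
L-branch≢R-branch c {u} {s} eq with () ← ∷-injectiveˡ (++-cancelˡ c _ _ (trans (sym (++-assoc c (L ∷ u) s)) eq))

fork-unique : ∀ c c′ {u u′ t t′} → c ++ L ∷ u ≡ c′ ++ L ∷ u′ → c ++ R ∷ t ≡ c′ ++ R ∷ t′ → c ≡ c′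
fork-unique []      []       _  _  = refl
fork-unique []      (L ∷ c′) _  ()
fork-unique []      (R ∷ c′) () _
fork-unique (L ∷ c) []       _  ()
fork-unique (R ∷ c) []       () _
fork-unique (d ∷ c) (d′ ∷ c′) eqL eqR with refl ← ∷-injectiveˡ eqL =
  cong (d ∷_) (fork-unique c c′ (∷-injectiveʳ eqL) (∷-injectiveʳ eqR))

blacks231-injective : ∀ {k k′} → blacks231 k ≡ blacks231 k′ → k ≡ k′
blacks231-injective {adjacent c u t} {adjacent _ _ _} eq
  with refl ← cong (proj₁ ∘ proj₂) eq
  with refl ← ++-∷-cancelˡ c (cong proj₁ eq) | refl ← ++-∷-cancelˡ c (cong (proj₂ ∘ proj₂) eq) = refl
blacks231-injective {separated c u v t} {separated c′ _ _ _} eq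
  with refl ← fork-unique c c′ (cong (proj₁ ∘ proj₂) eq) (cong (proj₂ ∘ proj₂) eq)
  with refl ← ++-∷-cancelˡ c (cong (proj₁ ∘ proj₂) eq)
  with refl ← ++-∷-cancelˡ u (++-∷-cancelˡ c (cong proj₁ eq)) | refl ← ++-∷-cancelˡ c (cong (proj₂ ∘ proj₂) eq) = refl
blacks231-injective {adjacent c u t} {separated c′ u′ _ _} eq with refl ← cong (proj₁ ∘ proj₂) eq =
  ⊥-elim (L-branch≢R-branch c′ (cong (proj₂ ∘ proj₂) eq))
blacks231-injective {separated c u _ _} {adjacent c′ u′ t′} eq with refl ← cong (proj₁ ∘ proj₂) eq =
  ⊥-elim (L-branch≢R-branch c (sym (cong (proj₂ ∘ proj₂) eq)))

-- Exchanging right subtrees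

Vertex-++⁻ : ∀ T p q → Vertex T (p ++ q) → Vertex T p
Vertex-++⁻ (nd l r) []      q _ = tt
Vertex-++⁻ (nd l r) (L ∷ p) q v = Vertex-++⁻ l p q v
Vertex-++⁻ (nd l r) (R ∷ p) q v = Vertex-++⁻ r p q v

Vertex-subtreeAt : ∀ T p q → Vertex T (p ++ q) → Vertex (subtreeAt T p) q
Vertex-subtreeAt T        []      q v = v
Vertex-subtreeAt (nd l r) (L ∷ p) q v = Vertex-subtreeAt l p q v
Vertex-subtreeAt (nd l r) (R ∷ p) q v = Vertex-subtreeAt r p q v

Vertex-replaceAt-above : ∀ T q d s S → Vertex T q → Vertex (replaceAt T (q ++ d ∷ s) S) q
Vertex-replaceAt-above (nd l r) []      L s S _ = tt
Vertex-replaceAt-above (nd l r) []      R s S _ = tt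
Vertex-replaceAt-above (nd l r) (L ∷ q) d s S v = Vertex-replaceAt-above l q d s S v
Vertex-replaceAt-above (nd l r) (R ∷ q) d s S v = Vertex-replaceAt-above r q d s S v

Vertex-replaceAt-beside : ∀ T u v s S → Vertex T (u ++ L ∷ v) → Vertex (replaceAt T (u ++ R ∷ s) S) (u ++ L ∷ v)
Vertex-replaceAt-beside (nd l r) []      v s S w = w
Vertex-replaceAt-beside (nd l r) (L ∷ u) v s S w = Vertex-replaceAt-beside l u v s S w
Vertex-replaceAt-beside (nd l r) (R ∷ u) v s S w = Vertex-replaceAt-beside r u v s S w

Vertex-graft : ∀ T u t S → Vertex T u → Vertex S t → Vertex (replaceAt T (u ++ R ∷ []) S) (u ++ R ∷ t)
Vertex-graft (nd l r) []      t S _ w = w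
Vertex-graft (nd l r) (L ∷ u) t S v w = Vertex-graft l u t S v w
Vertex-graft (nd l r) (R ∷ u) t S v w = Vertex-graft r u t S v w

size-replaceAt : ∀ T u S → Vertex T u →
  size (replaceAt T (u ++ R ∷ []) S) + size (subtreeAt T (u ++ R ∷ [])) ≡ size T + size S
size-replaceAt (nd l r) [] S _ = exchange (size l + 1) (size S) (size r)
  where
  exchange : ∀ a b c → a + b + c ≡ a + c + b
  exchange = solve-∀
size-replaceAt (nd l r) (L ∷ u) S v = begin
  size l′ + 1 + size r + size s′ ≡⟨ regroup (size l′) (size r) (size s′) ⟩
  size l′ + size s′ + 1 + size r ≡⟨ cong (λ m → m + 1 + size r) (size-replaceAt l u S v) ⟩
  size l + size S + 1 + size r   ≡⟨ regroup (size l) (size r) (size S) ⟨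
  size l + 1 + size r + size S   ∎
  where
  open ≡-Reasoning
  l′ = replaceAt l (u ++ R ∷ []) S
  s′ = subtreeAt l (u ++ R ∷ [])
  regroup : ∀ a b c → a + 1 + b + c ≡ a + c + 1 + b
  regroup = solve-∀
size-replaceAt (nd l r) (R ∷ u) S v = begin
  size l + 1 + size r′ + size s′   ≡⟨ +-assoc (size l + 1) (size r′) (size s′) ⟩
  size l + 1 + (size r′ + size s′) ≡⟨ cong (size l + 1 +_) (size-replaceAt r u S v) ⟩
  size l + 1 + (size r + size S)   ≡⟨ +-assoc (size l + 1) (size r) (size S) ⟨
  size l + 1 + size r + size S     ∎
  where
  open ≡-Reasoning
  r′ = replaceAt r (u ++ R ∷ []) S
  s′ = subtreeAt r (u ++ R ∷ [])

replaceAt-replaceAt : ∀ T p S S′ → replaceAt (replaceAt T p S) p S′ ≡ replaceAt T p S′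
replaceAt-replaceAt T        []      S S′ = refl
replaceAt-replaceAt lf       (d ∷ p) S S′ = refl
replaceAt-replaceAt (nd l r) (L ∷ p) S S′ = cong (λ l′ → nd l′ r) (replaceAt-replaceAt l p S S′)
replaceAt-replaceAt (nd l r) (R ∷ p) S S′ = cong (nd l) (replaceAt-replaceAt r p S S′)

replaceAt-subtreeAt : ∀ T p → replaceAt T p (subtreeAt T p) ≡ T
replaceAt-subtreeAt T        []      = refl
replaceAt-subtreeAt lf       (d ∷ p) = refl
replaceAt-subtreeAt (nd l r) (L ∷ p) = cong (λ l′ → nd l′ r) (replaceAt-subtreeAt l p)
replaceAt-subtreeAt (nd l r) (R ∷ p) = cong (nd l) (replaceAt-subtreeAt r p)

subtreeAt-replaceAt : ∀ T u S → Vertex T u → subtreeAt (replaceAt T (u ++ R ∷ []) S) (u ++ R ∷ []) ≡ S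
subtreeAt-replaceAt (nd l r) []      S _ = refl
subtreeAt-replaceAt (nd l r) (L ∷ u) S v = subtreeAt-replaceAt l u S v
subtreeAt-replaceAt (nd l r) (R ∷ u) S v = subtreeAt-replaceAt r u S v

size-swapRight : ∀ T c u → Vertex T (c ++ L ∷ u) → size (swapRight T (c ++ L ∷ u) c) ≡ size T
size-swapRight (nd l r) [] u v = begin
  size l′ + 1 + size s′   ≡⟨ regroup (size l′) (size s′) ⟩
  size l′ + size s′ + 1   ≡⟨ cong (_+ 1) (size-replaceAt l u r v) ⟩
  size l + size r + 1     ≡⟨ regroup (size l) (size r) ⟨
  size l + 1 + size r     ∎
  where
  open ≡-Reasoning
  l′ = replaceAt l (u ++ R ∷ []) r
  s′ = subtreeAt l (u ++ R ∷ [])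
  regroup : ∀ a b → a + 1 + b ≡ a + b + 1
  regroup = solve-∀
size-swapRight (nd l r) (L ∷ c) u v = cong (λ m → m + 1 + size r) (size-swapRight l c u v)
size-swapRight (nd l r) (R ∷ c) u v = cong (size l + 1 +_) (size-swapRight r c u v)

swapRight-involutive : ∀ T c u → Vertex T (c ++ L ∷ u) →
  swapRight (swapRight T (c ++ L ∷ u) c) (c ++ L ∷ u) c ≡ T
swapRight-involutive (nd l r) [] u v =
  cong₂ nd (trans (replaceAt-replaceAt l (u ++ R ∷ []) r _) (replaceAt-subtreeAt l (u ++ R ∷ [])))
           (subtreeAt-replaceAt l u r v)
swapRight-involutive (nd l r) (L ∷ c) u v = cong (λ l′ → nd l′ r) (swapRight-involutive l c u v)
swapRight-involutive (nd l r) (R ∷ c) u v = cong (nd l) (swapRight-involutive r c u v)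

swapRight-Vertex-apex : ∀ T c u → Vertex T (c ++ L ∷ u) → Vertex (swapRight T (c ++ L ∷ u) c) c
swapRight-Vertex-apex (nd l r) []      u _ = tt
swapRight-Vertex-apex (nd l r) (L ∷ c) u v = swapRight-Vertex-apex l c u v
swapRight-Vertex-apex (nd l r) (R ∷ c) u v = swapRight-Vertex-apex r c u v

swapRight-Vertex-pivot : ∀ T c u → Vertex T (c ++ L ∷ u) → Vertex (swapRight T (c ++ L ∷ u) c) (c ++ L ∷ u)
swapRight-Vertex-pivot (nd l r) []      u v = Vertex-replaceAt-above l u R [] r v
swapRight-Vertex-pivot (nd l r) (L ∷ c) u v = swapRight-Vertex-pivot l c u v
swapRight-Vertex-pivot (nd l r) (R ∷ c) u v = swapRight-Vertex-pivot r c u v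

swapRight-Vertex-pivot-left : ∀ T c u w → Vertex T (c ++ L ∷ (u ++ L ∷ w)) →
  Vertex (swapRight T (c ++ L ∷ u) c) (c ++ L ∷ (u ++ L ∷ w))
swapRight-Vertex-pivot-left (nd l r) []      u w h = Vertex-replaceAt-beside l u w [] r h
swapRight-Vertex-pivot-left (nd l r) (L ∷ c) u w h = swapRight-Vertex-pivot-left l c u w h
swapRight-Vertex-pivot-left (nd l r) (R ∷ c) u w h = swapRight-Vertex-pivot-left r c u w h

swapRight-Vertex-pivot→apex : ∀ T c u t → Vertex T (c ++ L ∷ (u ++ R ∷ t)) →
  Vertex (swapRight T (c ++ L ∷ u) c) (c ++ R ∷ t)
swapRight-Vertex-pivot→apex (nd l r) [] u t h =
  Vertex-subtreeAt l (u ++ R ∷ []) t (subst (Vertex l) (sym (++-assoc u (R ∷ []) t)) h)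
swapRight-Vertex-pivot→apex (nd l r) (L ∷ c) u t h = swapRight-Vertex-pivot→apex l c u t h
swapRight-Vertex-pivot→apex (nd l r) (R ∷ c) u t h = swapRight-Vertex-pivot→apex r c u t h

swapRight-Vertex-apex→pivot : ∀ T c u t → Vertex T (c ++ L ∷ u) → Vertex T (c ++ R ∷ t) →
  Vertex (swapRight T (c ++ L ∷ u) c) (c ++ L ∷ (u ++ R ∷ t))
swapRight-Vertex-apex→pivot (nd l r) []      u t v w = Vertex-graft l u t r v w
swapRight-Vertex-apex→pivot (nd l r) (L ∷ c) u t v w = swapRight-Vertex-apex→pivot l c u t v w
swapRight-Vertex-apex→pivot (nd l r) (R ∷ c) u t v w = swapRight-Vertex-apex→pivot r c u t v w

interchange : Tree → Config → Tree
interchange T k = swapRight T (pivot k) (apex k)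

size-interchange : ∀ T k → Vertex T (pivot k) → size (interchange T k) ≡ size T
size-interchange T (adjacent c u _)    = size-swapRight T c u
size-interchange T (separated c u _ _) = size-swapRight T c u

interchange-involutive : ∀ T k → Vertex T (pivot k) → interchange (interchange T k) k ≡ T
interchange-involutive T (adjacent c u _)    = swapRight-involutive T c u
interchange-involutive T (separated c u _ _) = swapRight-involutive T c u

interchange-injective : ∀ T₁ T₂ k → Vertex T₁ (pivot k) → Vertex T₂ (pivot k) →
  interchange T₁ k ≡ interchange T₂ k → T₁ ≡ T₂
interchange-injective T₁ T₂ k v₁ v₂ eq = begin
  T₁                                 ≡⟨ interchange-involutive T₁ k v₁ ⟨
  interchange (interchange T₁ k) k   ≡⟨ cong (λ S → interchange S k) eq ⟩
  interchange (interchange T₂ k) k   ≡⟨ interchange-involutive T₂ k v₂ ⟩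
  T₂                                 ∎
  where open ≡-Reasoning

pivot-Vertex213 : ∀ T k → Vertices T (blacks213 k) → Vertex T (pivot k)
pivot-Vertex213 T (adjacent c u t)    (va , _) = va
pivot-Vertex213 T (separated c u v t) (va , _) =
  Vertex-++⁻ T (c ++ L ∷ u) (L ∷ v) (subst (Vertex T) (sym (++-assoc c (L ∷ u) (L ∷ v))) va)

pivot-Vertex231 : ∀ T k → Vertices T (blacks231 k) → Vertex T (pivot k)
pivot-Vertex231 T (adjacent c u t)    (va , _)      = va
pivot-Vertex231 T (separated c u v t) (_ , vb , _) = vb

interchange-Vertices213 : ∀ T k → Vertices T (blacks213 k) → Vertices (interchange T k) (blacks231 k)
interchange-Vertices213 T (adjacent c u t) (va , vb , _) =
  swapRight-Vertex-pivot T c u va , swapRight-Vertex-apex T c u va , swapRight-Vertex-pivot→apex T c u t vb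
interchange-Vertices213 T k@(separated c u v t) vs@(va , vb , _) =
  swapRight-Vertex-pivot-left T c u v va , swapRight-Vertex-pivot T c u (pivot-Vertex213 T k vs) ,
  swapRight-Vertex-pivot→apex T c u t vb

interchange-Vertices231 : ∀ T k → Vertices T (blacks231 k) → Vertices (interchange T k) (blacks213 k)
interchange-Vertices231 T (adjacent c u t) (va , _ , vc) =
  swapRight-Vertex-pivot T c u va , swapRight-Vertex-apex→pivot T c u t va vc , swapRight-Vertex-apex T c u va
interchange-Vertices231 T (separated c u v t) (va , vb , vc) =
  swapRight-Vertex-pivot-left T c u v va , swapRight-Vertex-apex→pivot T c u t vb vc ,
  swapRight-Vertex-apex T c u vb

InA⇒blacks213 : ∀ T {abc} → InA n (T , abc) → ∃ λ k → abc ≡ blacks213 k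
InA⇒blacks213 T {abc} x∈A = order213⇒blacks213 (proj₂ (proj₂ (Equivalence.to (InA⇔ T abc) x∈A)))

InB⇒blacks231 : ∀ T {abc} → InB n (T , abc) → ∃ λ k → abc ≡ blacks231 k
InB⇒blacks231 T {abc} y∈B = order231⇒blacks231 (proj₂ (proj₂ (Equivalence.to (InB⇔ T abc) y∈B)))

InA⇒pivot : ∀ T k → InA n (T , blacks213 k) → Vertex T (pivot k)
InA⇒pivot T k x∈A = pivot-Vertex213 T k (proj₁ (proj₂ (Equivalence.to (InA⇔ T (blacks213 k)) x∈A)))

InB⇒pivot : ∀ T k → InB n (T , blacks231 k) → Vertex T (pivot k)
InB⇒pivot T k y∈B = pivot-Vertex231 T k (proj₁ (proj₂ (Equivalence.to (InB⇔ T (blacks231 k)) y∈B)))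

interchange-A⇒B : ∀ T k → InA n (T , blacks213 k) → InB n (interchange T k , blacks231 k)
interchange-A⇒B T k x∈A with size≡n , vs , _ ← Equivalence.to (InA⇔ T (blacks213 k)) x∈A =
  Equivalence.from (InB⇔ (interchange T k) (blacks231 k))
    (trans (size-interchange T k (pivot-Vertex213 T k vs)) size≡n , interchange-Vertices213 T k vs , blacks231-order k)

interchange-B⇒A : ∀ T k → InB n (T , blacks231 k) → InA n (interchange T k , blacks213 k)
interchange-B⇒A T k y∈B with size≡n , vs , _ ← Equivalence.to (InB⇔ T (blacks231 k)) y∈B =
  Equivalence.from (InA⇔ (interchange T k) (blacks213 k))
    (trans (size-interchange T k (pivot-Vertex231 T k vs)) size≡n , interchange-Vertices231 T k vs , blacks213-order k)

-- Evaluating f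

isPrefix-++ : ∀ p q r → isPrefix (p ++ q) (p ++ r) ≡ isPrefix q r
isPrefix-++ []      q r = refl
isPrefix-++ (L ∷ p) q r = isPrefix-++ p q r
isPrefix-++ (R ∷ p) q r = isPrefix-++ p q r

isRightDesc-++ : ∀ p q r → isRightDesc (p ++ q) (p ++ r) ≡ isRightDesc q r
isRightDesc-++ p q r =
  trans (cong (λ x → isPrefix x (p ++ q)) (++-assoc p r (R ∷ []))) (isPrefix-++ p (r ++ R ∷ []) q)

isRightDesc-p++R∷t : ∀ p t → isRightDesc (p ++ R ∷ t) p ≡ true
isRightDesc-p++R∷t p t = isPrefix-++ p (R ∷ []) (R ∷ t)

isLeftDesc-p++L∷s : ∀ p s → isLeftDesc (p ++ L ∷ s) p ≡ true
isLeftDesc-p++L∷s p s = isPrefix-++ p (L ∷ []) (L ∷ s)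

filterᵇ-map : ∀ (P : A → Bool) (g : A → A) xs → filterᵇ P (map g xs) ≡ map g (filterᵇ (P ∘ g) xs)
filterᵇ-map P g [] = refl
filterᵇ-map P g (x ∷ xs) with P (g x)
... | true  = cong (g x ∷_) (filterᵇ-map P g xs)
... | false = filterᵇ-map P g xs

filterᵇ-none : ∀ (P : A → Bool) → (∀ x → P x ≡ false) → ∀ xs → filterᵇ P xs ≡ []
filterᵇ-none P P≡false [] = refl
filterᵇ-none P P≡false (x ∷ xs) rewrite P≡false x = filterᵇ-none P P≡false xs

last-filterᵇ-inits-∷ : ∀ (P : List A → Bool) x xs → P [] ≡ false →
  last (filterᵇ P (inits (x ∷ xs))) ≡ Maybe.map (x ∷_) (last (filterᵇ (P ∘ (x ∷_)) (inits xs)))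
last-filterᵇ-inits-∷ P x xs P[]≡false rewrite P[]≡false =
  trans (cong last (filterᵇ-map P (x ∷_) (inits xs))) (last-map (x ∷_) (filterᵇ (P ∘ (x ∷_)) (inits xs)))

qxCandidate : Path → Path → Path → Path → Bool
qxCandidate q2 q1 q3 x = isLeftDesc x q3 ∧ isLeftDesc q2 x ∧ isRightDesc q1 x

splits : Path → Path → Path → Bool
splits a b x = isLeftDesc a x ∧ isRightDesc b x

lowestQx-∷ : ∀ d a b c → lowestQx (d ∷ a) (d ∷ b) (d ∷ c) ≡ Maybe.map (d ∷_) (lowestQx a b c)
lowestQx-∷ L a b c = last-filterᵇ-inits-∷ (qxCandidate (L ∷ a) (L ∷ b) (L ∷ c)) L a refl
lowestQx-∷ R a b c = last-filterᵇ-inits-∷ (qxCandidate (R ∷ a) (R ∷ b) (R ∷ c)) R a refl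

last-splits : ∀ u v t → last (filterᵇ (splits (u ++ L ∷ v) (u ++ R ∷ t)) (inits (u ++ L ∷ v))) ≡ just u
last-splits [] v t = cong (λ xs → last ([] ∷ xs)) (begin
  filterᵇ P (map (L ∷_) (inits v))             ≡⟨ filterᵇ-map P (L ∷_) (inits v) ⟩
  map (L ∷_) (filterᵇ (P ∘ (L ∷_)) (inits v)) ≡⟨ cong (map (L ∷_)) (filterᵇ-none _ (λ x → ∧-zeroʳ (isLeftDesc (L ∷ v) (L ∷ x))) (inits v)) ⟩
  []                                           ∎)
  where
  open ≡-Reasoning
  P = splits (L ∷ v) (R ∷ t)
last-splits (L ∷ u) v t =
  trans (last-filterᵇ-inits-∷ (splits (L ∷ (u ++ L ∷ v)) (L ∷ (u ++ R ∷ t))) L (u ++ L ∷ v) refl)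
        (cong (Maybe.map (L ∷_)) (last-splits u v t))
last-splits (R ∷ u) v t =
  trans (last-filterᵇ-inits-∷ (splits (R ∷ (u ++ L ∷ v)) (R ∷ (u ++ R ∷ t))) R (u ++ L ∷ v) refl)
        (cong (Maybe.map (R ∷_)) (last-splits u v t))

lowestQx-separated : ∀ c u v t → lowestQx (c ++ L ∷ (u ++ L ∷ v)) (c ++ L ∷ (u ++ R ∷ t)) c ≡ just (c ++ L ∷ u)
lowestQx-separated [] u v t =
  trans (last-filterᵇ-inits-∷ (qxCandidate (L ∷ (u ++ L ∷ v)) (L ∷ (u ++ R ∷ t)) []) L (u ++ L ∷ v) refl)
        (cong (Maybe.map (L ∷_)) (last-splits u v t))
lowestQx-separated (d ∷ c) u v t =
  trans (lowestQx-∷ d _ _ c) (cong (Maybe.map (d ∷_)) (lowestQx-separated c u v t))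

drop-length-++ : ∀ (p q : Path) → drop (length p) (p ++ q) ≡ q
drop-length-++ []      q = refl
drop-length-++ (x ∷ p) q = drop-length-++ p q

drop-pivot : ∀ c u t → drop (length (c ++ L ∷ u)) (c ++ L ∷ (u ++ R ∷ t)) ≡ R ∷ t
drop-pivot c u t =
  trans (cong (drop (length (c ++ L ∷ u))) (sym (++-assoc c (L ∷ u) (R ∷ t)))) (drop-length-++ (c ++ L ∷ u) (R ∷ t))

f-blacks213 : ∀ T k → f (T , blacks213 k) ≡ (interchange T k , blacks231 k)
f-blacks213 T (adjacent c u t)
  rewrite isRightDesc-++ c (L ∷ (u ++ R ∷ t)) (L ∷ u) | isRightDesc-p++R∷t u t | isLeftDesc-p++L∷s c u
        | drop-pivot c u t = refl
f-blacks213 T (separated c u v t)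
  rewrite isRightDesc-++ c (L ∷ (u ++ R ∷ t)) (L ∷ (u ++ L ∷ v)) | isRightDesc-++ u (R ∷ t) (L ∷ v)
        | lowestQx-separated c u v t | drop-pivot c u t = refl

mainTheorem2 : (n : ℕ) → 1 ≤ n →
    ((x : ColTree) → InA n x → InB n (f x)) ×
    ((x y : ColTree) → InA n x → InA n y → f x ≡ f y → x ≡ y) ×
    ((y : ColTree) → InB n y → Σ ColTree (λ x → InA n x × f x ≡ y))
mainTheorem2 n _ = into-B , injective , surjective
  where
  into-B : (x : ColTree) → InA n x → InB n (f x)
  into-B (T , _) x∈A with k , refl ← InA⇒blacks213 T x∈A =
    subst (InB n) (sym (f-blacks213 T k)) (interchange-A⇒B T k x∈A)

  injective : (x y : ColTree) → InA n x → InA n y → f x ≡ f y → x ≡ y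
  injective (T₁ , _) (T₂ , _) x∈A y∈A fx≡fy
    with k₁ , refl ← InA⇒blacks213 T₁ x∈A | k₂ , refl ← InA⇒blacks213 T₂ y∈A
    with eq ← trans (sym (f-blacks213 T₁ k₁)) (trans fx≡fy (f-blacks213 T₂ k₂))
    with refl ← blacks231-injective (cong proj₂ eq) =
    cong (_, blacks213 k₁) (interchange-injective T₁ T₂ k₁ (InA⇒pivot T₁ k₁ x∈A) (InA⇒pivot T₂ k₁ y∈A) (cong proj₁ eq))

  surjective : (y : ColTree) → InB n y → Σ ColTree (λ x → InA n x × f x ≡ y)
  surjective (T , _) y∈B with k , refl ← InB⇒blacks231 T y∈B =
    (interchange T k , blacks213 k) , interchange-B⇒A T k y∈B ,
    trans (f-blacks213 (interchange T k) k) (cong (_, blacks231 k) (interchange-involutive T k (InB⇒pivot T k y∈B)))
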